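{- Let $M$ be a finite abelian group of order $m$, $J$ a Jacobi function on $M$, and suppose $c\in\hat{M}$ with $c^2=1$ and a bijection $i\colon \hat{M}\setminus\{c\}\to\hat{M}\setminus\{1\}$ satisfy $i(x)=x\,i(x^{ -1})$ for all $x\in\hat{M}\setminus\{c\}$ and $J(\alpha,\beta)=\frac{1}{m}\sum_{x\in\hat{M}\setminus\{c\}}\alpha(i(x))\beta(i(x)x^{ -1})$ for all $\alpha,\beta\in M$. Let $F=\hat{M}\sqcup\{0\}$ with multiplication extending that of $\hat{M}$ by $0\cdot x=x\cdot 0=0$, and define $\oplus$ on $F$ by: $0$ is the identity for $\oplus$, and for nonzero $x,y$, $x\oplus y=0$ if $x=cy$ and $x\oplus y=x\,i(x/y)^{ -1}$ otherwise. Then $\oplus$ is associative.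
   Context: $\hat{M}$ is the Pontryagin dual of $M$ (written multiplicatively, identity $1$), and $\alpha(x)$ is the pairing of $\alpha\in M$ with $x\in\hat{M}$. $\delta(\alpha)=1$ if $\alpha$ is the identity of $M$, else $0$. A Jacobi function on $M$ is a function $J \colon M\times M \to \mathbf{C}$ satisfying: (A) $J(\alpha,\beta)=J(\beta,\alpha)$; (B) with $J^*(\alpha,\beta)=J(\alpha,\beta)-\delta(\alpha)-\delta(\beta)$, $J^*(\alpha,\beta)J^*(\alpha\beta,\gamma)=J^*(\alpha,\beta\gamma)J^*(\beta,\gamma)$ for all $\alpha,\beta,\gamma$; (C) $\sum_{\beta\in M} J(\alpha_1\beta,\alpha_2\beta^{ -1})J(\alpha_3\beta,\alpha_4\beta^{ -1}) = J(\alpha_1\alpha_4,\alpha_2\alpha_3)$ for all $\alpha_1,\dots,\alpha_4 \in M$. -}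

module Defs where

open import Level using (Level; _⊔_) renaming (suc to lsuc)
open import Algebra.Bundles using (CommutativeRing)
open import Data.Nat using (ℕ; zero; suc)
open import Data.Fin using (Fin; _≟_) renaming (zero to fzero; suc to fsuc)
open import Data.Maybe using (Maybe; just; nothing)
open import Data.Product using (Σ; _×_; _,_)
open import Relation.Nullary using (¬_; Dec; yes; no)
open import Relation.Binary.PropositionalEquality using (_≡_; _≢_)

record Field (c ℓ : Level) : Set (lsuc (c ⊔ ℓ)) where
  field
    commutativeRing : CommutativeRing c ℓ
  open CommutativeRing commutativeRing public
  field
    _⁻¹      : Carrier → Carrier
    inverseʳ : ∀ x → ¬ (x ≈ 0#) → x * (x ⁻¹) ≈ 1#
    1≉0      : ¬ (1# ≈ 0#)

module _ {c ℓ : Level} (K : Field c ℓ) where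
  open Field K

  fromℕ : ℕ → Carrier
  fromℕ zero    = 0#
  fromℕ (suc n) = 1# + fromℕ n

  CharZero : Set ℓ
  CharZero = ∀ n → ¬ (fromℕ (suc n) ≈ 0#)

  sumK : ∀ {n} → (Fin n → Carrier) → Carrier
  sumK {zero}  f = 0#
  sumK {suc n} f = f fzero + sumK {n} (λ k → f (fsuc k))

  ifDec : ∀ {p} {P : Set p} → Dec P → Carrier → Carrier → Carrier
  ifDec (yes _) a b = a
  ifDec (no _)  a b = b

  sumExcept : ∀ {n} → Fin n → (Fin n → Carrier) → Carrier
  sumExcept c f = sumK (λ x → ifDec (x ≟ c) 0# (f x))

-- A finite abelian group of order n, with carrier Fin n
-- (every finite abelian group of order n is isomorphic to one of these).

record FinAbGroup (n : ℕ) : Set where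
  field
    _∙_       : Fin n → Fin n → Fin n
    ε         : Fin n
    _⁻¹       : Fin n → Fin n
    assoc     : ∀ x y z → (x ∙ y) ∙ z ≡ x ∙ (y ∙ z)
    comm      : ∀ x y → x ∙ y ≡ y ∙ x
    identityˡ : ∀ x → ε ∙ x ≡ x
    inverseˡ  : ∀ x → (x ⁻¹) ∙ x ≡ ε

-- Pontryagin duality for finite groups, with values in a field K:
-- X (of the same order as M) is the dual of M via a perfect pairing
-- ⟨α , x⟩ = α(x), bimultiplicative and nondegenerate on both sides.
-- (The induced map X → Hom(M, K*) is then an isomorphism.)

record DualPairing {c ℓ : Level} (K : Field c ℓ) {m : ℕ}
                   (M X : FinAbGroup m) : Set (c ⊔ ℓ) where
  open Field K
  private
    module M = FinAbGroup M
    module X = FinAbGroup X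
  field
    ⟨_,_⟩    : Fin m → Fin m → Carrier
    mulˡ     : ∀ α β x → ⟨ α M.∙ β , x ⟩ ≈ ⟨ α , x ⟩ * ⟨ β , x ⟩
    mulʳ     : ∀ α x y → ⟨ α , x X.∙ y ⟩ ≈ ⟨ α , x ⟩ * ⟨ α , y ⟩
    unitˡ    : ∀ x → ⟨ M.ε , x ⟩ ≈ 1#
    unitʳ    : ∀ α → ⟨ α , X.ε ⟩ ≈ 1#
    nondegˡ  : ∀ α → (∀ x → ⟨ α , x ⟩ ≈ 1#) → α ≡ M.ε
    nondegʳ  : ∀ x → (∀ α → ⟨ α , x ⟩ ≈ 1#) → x ≡ X.ε

module _ {c ℓ : Level} (K : Field c ℓ) {m : ℕ} (M : FinAbGroup m) where
  open Field K
  open FinAbGroup M renaming (_⁻¹ to _⁻¹ᴹ)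

  δ : Fin m → Carrier
  δ α = ifDec K (α ≟ ε) 1# 0#

  Jstar : (Fin m → Fin m → Carrier) → Fin m → Fin m → Carrier
  Jstar J α β = J α β + (- δ α) + (- δ β)

  record IsJacobi (J : Fin m → Fin m → Carrier) : Set ℓ where
    field
      symm    : ∀ α β → J α β ≈ J β α
      cocycle : ∀ α β γ →
        Jstar J α β * Jstar J (α ∙ β) γ ≈ Jstar J α (β ∙ γ) * Jstar J β γ
      conv    : ∀ α₁ α₂ α₃ α₄ →
        sumK K (λ β → J (α₁ ∙ β) (α₂ ∙ (β ⁻¹ᴹ)) * J (α₃ ∙ β) (α₄ ∙ (β ⁻¹ᴹ)))
          ≈ J (α₁ ∙ α₄) (α₂ ∙ α₃)

-- i : X ∖ {c} → X ∖ {1} a bijection, encoded as a total function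
-- Fin m → Fin m whose value at c is irrelevant.

module _ {m : ℕ} (X : FinAbGroup m) where
  open FinAbGroup X

  record IsBijectionOff (c : Fin m) (i : Fin m → Fin m) : Set where
    field
      maps-into : ∀ x → x ≢ c → i x ≢ ε
      injective : ∀ x y → x ≢ c → y ≢ c → i x ≡ i y → x ≡ y
      surjective : ∀ y → y ≢ ε → Σ (Fin m) (λ x → x ≢ c × i x ≡ y)

  -- F = X ⊔ {0}, represented as Maybe (Fin m) with nothing = 0.
  F : Set
  F = Maybe (Fin m)

  _·F_ : F → F → F
  nothing ·F y      = nothing
  just x  ·F nothing = nothing
  just x  ·F just y  = just (x ∙ y)

  plusF : (c : Fin m) (i : Fin m → Fin m) → F → F → F
  plusF c i nothing  y        = y
  plusF c i (just x) nothing  = just x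
  plusF c i (just x) (just y) with x ≟ c ∙ y
  ... | yes _ = nothing
  ... | no  _ = just (x ∙ (i (x ∙ (y ⁻¹)) ⁻¹))

{-# OPTIONS --safe #-}

-- Write E(u, v) = [u ⊕ v = 1]. Since u ⊕ v = 1 holds exactly for the pairs (i x, i x · x⁻¹) with
-- x ≠ c, the formula for J says that m·J is the Fourier transform of E, and subtracting δ(α) and
-- δ(β) turns this into: m·J* is the transform of E*(u, v) = E(u, v) − [u = 1] − [v = 1].
-- Transforming both sides of the cocycle identity for J* and using the symmetry of J* shows that
-- Q(a, b, d) = Σ_w E*(w, d) E*(a w⁻¹, b w⁻¹) is invariant under (a, b, d) ↦ (b, d, a).
-- As ⊕ is homogeneous, (u ⊕ v) s = u s ⊕ v s, this sum evaluates to [(a ⊕ b) ⊕ d = 1] minus a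
-- cyclically symmetric combination of the [x ⊕ y = 1] and [x = 1]. Hence (a ⊕ b) ⊕ d = 1 iff
-- (b ⊕ d) ⊕ a = 1; homogeneity upgrades this to (a ⊕ b) ⊕ d = (b ⊕ d) ⊕ a, which together with
-- the commutativity of ⊕ is associativity.

module Submission where

open import Defs
open import Level using (Level; 0ℓ)
open import Algebra.Bundles using (AbelianGroup; CommutativeRing)
open import Data.Nat using (ℕ; zero; suc)
open import Data.Fin using (Fin; _≟_) renaming (zero to fzero; suc to fsuc)
open import Data.Fin.Properties using (suc-injective)
open import Data.Fin.Permutation using (permutation)
open import Data.Maybe using (just; nothing)
import Data.Maybe.Properties as Maybe
open import Data.Product using (Σ; _×_; _,_)
open import Relation.Nullary using (¬_; Dec; yes; no; ¬?; contradiction)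
open import Relation.Nullary.Negation using (¬¬-map)
open import Relation.Nullary.Decidable using (decidable-stable)
open import Relation.Binary.PropositionalEquality as ≡ using (_≡_; _≢_)
import Algebra.Properties.CommutativeSemigroup
import Algebra.Solver.CommutativeMonoid

abelianGroup : ∀ {n} → FinAbGroup n → AbelianGroup 0ℓ 0ℓ
abelianGroup G = record
  { Carrier        = Fin _
  ; _≈_            = _≡_
  ; _∙_            = _∙_
  ; ε              = ε
  ; _⁻¹            = _⁻¹
  ; isAbelianGroup = record
    { isGroup = record
      { isMonoid = record
        { isSemigroup = record
          { isMagma = record { isEquivalence = isEquivalence ; ∙-cong = cong₂ _∙_ }
          ; assoc   = assoc
          }
        ; identity = identityˡ , λ x → trans (comm x ε) (identityˡ x)
        }
      ; inverse = inverseˡ , λ x → trans (comm x (x ⁻¹)) (inverseˡ x)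
      ; ⁻¹-cong = cong _⁻¹
      }
    ; comm = comm
    }
  }
  where
  open FinAbGroup G
  open ≡ using (isEquivalence; cong; cong₂; trans)

module FinAbGroupProperties {n} (G : FinAbGroup n) where
  open ≡ using (refl; sym; trans)
  open AbelianGroup (abelianGroup G) public
    using (_∙_; ε; _⁻¹; assoc; comm; identityˡ; identityʳ; inverseˡ; inverseʳ; ∙-congˡ; ∙-congʳ)
  open import Algebra.Properties.AbelianGroup (abelianGroup G) public
  open import Algebra.Properties.CommutativeSemigroup
    (AbelianGroup.commutativeSemigroup (abelianGroup G)) public
  open ≡.≡-Reasoning

  ∙-/-cancelʳ : ∀ x y s → (x ∙ s) ∙ (y ∙ s) ⁻¹ ≡ x ∙ y ⁻¹
  ∙-/-cancelʳ x y s = begin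
    (x ∙ s) ∙ (y ∙ s) ⁻¹        ≡⟨ ∙-congˡ (⁻¹-∙-comm y s) ⟨
    (x ∙ s) ∙ (y ⁻¹ ∙ s ⁻¹)     ≡⟨ interchange x s (y ⁻¹) (s ⁻¹) ⟩
    (x ∙ y ⁻¹) ∙ (s ∙ s ⁻¹)     ≡⟨ ∙-congˡ (inverseʳ s) ⟩
    (x ∙ y ⁻¹) ∙ ε              ≡⟨ identityʳ _ ⟩
    x ∙ y ⁻¹                    ∎

  x∙[y/x]≡y : ∀ x y → x ∙ (y ∙ x ⁻¹) ≡ y
  x∙[y/x]≡y x y = trans (sym (assoc x y (x ⁻¹))) (xyx⁻¹≈y x y)

  /≡⇒≡∙ : ∀ {x y z} → x ∙ y ⁻¹ ≡ z → x ≡ z ∙ y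
  /≡⇒≡∙ {x} {y} refl = sym (//-rightDividesˡ y x)

  ≡∙⇒/≡ : ∀ {x y z} → x ≡ z ∙ y → x ∙ y ⁻¹ ≡ z
  ≡∙⇒/≡ {y = y} {z} refl = //-rightDividesʳ y z

  ∙⁻¹-cancelˡ : ∀ a {x y} → a ∙ x ⁻¹ ≡ a ∙ y ⁻¹ → x ≡ y
  ∙⁻¹-cancelˡ a e = ⁻¹-injective (∙-cancelˡ a _ _ e)

  x∙[x/y]⁻¹≡y : ∀ x y → x ∙ (x ∙ y ⁻¹) ⁻¹ ≡ y
  x∙[x/y]⁻¹≡y x y = trans (∙-congˡ (⁻¹-anti-homo‿- x y)) (x∙[y/x]≡y x y)

module ⊕-Properties {m} (X : FinAbGroup m) (c : Fin m)
    (c∙c≡ε : FinAbGroup._∙_ X c c ≡ FinAbGroup.ε X) (i : Fin m → Fin m)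
    (i-flip : ∀ x → x ≢ c → i x ≡ FinAbGroup._∙_ X x (i (FinAbGroup._⁻¹ X x))) where
  open FinAbGroupProperties X
  open ≡ using (refl; sym; trans; cong; cong₂)
  open ≡.≡-Reasoning

  infixl 6 _⊕_
  _⊕_ : F X → F X → F X
  _⊕_ = plusF X c i

  infixl 7 _·_
  _·_ : F X → F X → F X
  _·_ = _·F_ X

  ⊕-nothing : ∀ {x y} → x ≡ c ∙ y → just x ⊕ just y ≡ nothing
  ⊕-nothing {x} {y} x≡cy with x ≟ c ∙ y
  ... | yes _   = refl
  ... | no x≢cy = contradiction x≡cy x≢cy

  ⊕-just : ∀ {x y} → x ≢ c ∙ y → just x ⊕ just y ≡ just (x ∙ i (x ∙ y ⁻¹) ⁻¹)
  ⊕-just {x} {y} x≢cy with x ≟ c ∙ y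
  ... | yes x≡cy = contradiction x≡cy x≢cy
  ... | no _     = refl

  ⊕-identityʳ : ∀ u → u ⊕ nothing ≡ u
  ⊕-identityʳ nothing  = refl
  ⊕-identityʳ (just _) = refl

  ≡c∙-sym : ∀ {x y} → x ≡ c ∙ y → y ≡ c ∙ x
  ≡c∙-sym {y = y} refl = begin
    y            ≡⟨ identityˡ y ⟨
    ε ∙ y        ≡⟨ ∙-congʳ c∙c≡ε ⟨
    c ∙ c ∙ y    ≡⟨ assoc c c y ⟩
    c ∙ (c ∙ y)  ∎

  ⊕-comm : ∀ u v → u ⊕ v ≡ v ⊕ u
  ⊕-comm nothing  nothing  = refl
  ⊕-comm nothing  (just _) = refl
  ⊕-comm (just _) nothing  = refl
  ⊕-comm (just x) (just y) with x ≟ c ∙ y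
  ... | yes x≡cy = sym (⊕-nothing (≡c∙-sym x≡cy))
  ... | no x≢cy  = begin
    just (x ∙ i t ⁻¹)
      ≡⟨ cong (λ z → just (x ∙ z ⁻¹)) (i-flip t (λ t≡c → x≢cy (/≡⇒≡∙ t≡c))) ⟩
    just (x ∙ (t ∙ i (t ⁻¹)) ⁻¹)
      ≡⟨ cong just (∙-congˡ (⁻¹-∙-comm t _)) ⟨
    just (x ∙ (t ⁻¹ ∙ i (t ⁻¹) ⁻¹))
      ≡⟨ cong just (assoc x _ _) ⟨
    just (x ∙ t ⁻¹ ∙ i (t ⁻¹) ⁻¹)
      ≡⟨ cong (λ z → just (x ∙ z ∙ i z ⁻¹)) (⁻¹-anti-homo‿- x y) ⟩
    just (x ∙ s ∙ i s ⁻¹)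
      ≡⟨ cong (λ z → just (z ∙ i s ⁻¹)) (x∙[y/x]≡y x y) ⟩
    just (y ∙ i s ⁻¹)
      ≡⟨ ⊕-just (λ y≡cx → x≢cy (≡c∙-sym y≡cx)) ⟨
    just y ⊕ just x ∎
    where
    t = x ∙ y ⁻¹
    s = y ∙ x ⁻¹

  ·-distribʳ-⊕ : ∀ u v s → (u ⊕ v) · just s ≡ u · just s ⊕ v · just s
  ·-distribʳ-⊕ nothing  v        s = refl
  ·-distribʳ-⊕ (just x) nothing  s = refl
  ·-distribʳ-⊕ (just x) (just y) s with x ≟ c ∙ y
  ... | yes x≡cy = sym (⊕-nothing (trans (cong (_∙ s) x≡cy) (assoc c y s)))
  ... | no x≢cy  = begin
    just (x ∙ i (x ∙ y ⁻¹) ⁻¹ ∙ s)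
      ≡⟨ cong just (xy∙z≈xz∙y x _ s) ⟩
    just (x ∙ s ∙ i (x ∙ y ⁻¹) ⁻¹)
      ≡⟨ cong (λ z → just (x ∙ s ∙ i z ⁻¹)) (∙-/-cancelʳ x y s) ⟨
    just (x ∙ s ∙ i (x ∙ s ∙ (y ∙ s) ⁻¹) ⁻¹)
      ≡⟨ ⊕-just xs≢cys ⟨
    just (x ∙ s) ⊕ just (y ∙ s) ∎
    where
    xs≢cys : x ∙ s ≢ c ∙ (y ∙ s)
    xs≢cys e = x≢cy (∙-cancelʳ s x (c ∙ y) (trans e (sym (assoc c y s))))

  ·-distribʳ-⊕⊕ : ∀ u v w s → (u ⊕ v ⊕ w) · just s ≡ u · just s ⊕ v · just s ⊕ w · just s
  ·-distribʳ-⊕⊕ u v w s = trans (·-distribʳ-⊕ (u ⊕ v) w s) (cong (_⊕ w · just s) (·-distribʳ-⊕ u v s))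

  ·≡ε⇒≡⁻¹ : ∀ {z s} → z · just s ≡ just ε → z ≡ just (s ⁻¹)
  ·≡ε⇒≡⁻¹ {just x} {s} e = cong just (inverseˡ-unique x s (Maybe.just-injective e))

  q : Fin m → Fin m
  q x = i x ∙ x ⁻¹

  ⟨i,q⟩-injective : ∀ {x y} → i x ≡ i y → q x ≡ q y → x ≡ y
  ⟨i,q⟩-injective {x} {y} ix≡iy qx≡qy = ∙⁻¹-cancelˡ (i x) (trans qx≡qy (cong (_∙ y ⁻¹) (sym ix≡iy)))

  ⊕≡ε⇒ : ∀ {u v} → just u ⊕ just v ≡ just ε → Σ (Fin m) λ x → x ≢ c × i x ≡ u × q x ≡ v
  ⊕≡ε⇒ {u} {v} e with u ≟ c ∙ v
  ... | no u≢cv  = t , (λ t≡c → u≢cv (/≡⇒≡∙ t≡c)) , it≡u , (begin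
    i t ∙ t ⁻¹  ≡⟨ ∙-congʳ it≡u ⟩
    u ∙ t ⁻¹    ≡⟨ x∙[x/y]⁻¹≡y u v ⟩
    v           ∎)
    where
    t = u ∙ v ⁻¹
    it≡u : i t ≡ u
    it≡u = ⁻¹-injective (inverseʳ-unique u (i t ⁻¹)
             (Maybe.just-injective e))

  i⊕q≡ε : ∀ {x} → x ≢ c → just (i x) ⊕ just (q x) ≡ just ε
  i⊕q≡ε {x} x≢c with i x ≟ c ∙ (i x ∙ x ⁻¹)
  ... | yes e = contradiction (trans (sym (x∙[x/y]⁻¹≡y (i x) x)) (≡∙⇒/≡ e)) x≢c
  ... | no _  = cong just (trans (cong (λ z → i x ∙ i z ⁻¹) (x∙[x/y]⁻¹≡y (i x) x)) (inverseʳ (i x)))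

  -- By homogeneity, cyclic invariance of the event "= 1" is cyclic invariance of the value.
  module Associativity
      (cyclic-ε : ∀ a b d → just a ⊕ just b ⊕ just d ≡ just ε → just b ⊕ just d ⊕ just a ≡ just ε)
    where

    cyclic-just : ∀ a b d s → just a ⊕ just b ⊕ just d ≡ just s → just b ⊕ just d ⊕ just a ≡ just s
    cyclic-just a b d s e = begin
      just b ⊕ just d ⊕ just a
        ≡⟨ ·≡ε⇒≡⁻¹ (trans (·-distribʳ-⊕⊕ (just b) (just d) (just a) (s ⁻¹)) scaled) ⟩
      just (s ⁻¹ ⁻¹)
        ≡⟨ cong just (⁻¹-involutive s) ⟩
      just s ∎
      where
      scaled : just (b ∙ s ⁻¹) ⊕ just (d ∙ s ⁻¹) ⊕ just (a ∙ s ⁻¹) ≡ just ε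
      scaled = cyclic-ε (a ∙ s ⁻¹) (b ∙ s ⁻¹) (d ∙ s ⁻¹) (begin
        just (a ∙ s ⁻¹) ⊕ just (b ∙ s ⁻¹) ⊕ just (d ∙ s ⁻¹)
          ≡⟨ ·-distribʳ-⊕⊕ (just a) (just b) (just d) (s ⁻¹) ⟨
        (just a ⊕ just b ⊕ just d) · just (s ⁻¹)
          ≡⟨ cong (_· just (s ⁻¹)) e ⟩
        just (s ∙ s ⁻¹)
          ≡⟨ cong just (inverseʳ s) ⟩
        just ε ∎)

    cyclic : ∀ a b d → just a ⊕ just b ⊕ just d ≡ just b ⊕ just d ⊕ just a
    cyclic a b d with just a ⊕ just b ⊕ just d in e₁ | just b ⊕ just d ⊕ just a in e₂
    ... | just s  | _       = trans (sym (cyclic-just a b d s e₁)) e₂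
    ... | nothing | just s  =
      contradiction (trans (sym e₁) (cyclic-just d a b s (cyclic-just b d a s e₂))) λ ()
    ... | nothing | nothing = refl

    ⊕-assoc : ∀ u v w → u ⊕ v ⊕ w ≡ u ⊕ (v ⊕ w)
    ⊕-assoc nothing  v        w        = refl
    ⊕-assoc (just x) nothing  w        = refl
    ⊕-assoc (just x) (just y) nothing  = ⊕-identityʳ (just x ⊕ just y)
    ⊕-assoc (just x) (just y) (just z) = trans (cyclic x y z) (⊕-comm (just y ⊕ just z) (just x))

module Sums {a ℓ : Level} (R : CommutativeRing a ℓ) where
  open CommutativeRing R
  open import Algebra.Properties.Ring ring using (-0#≈0#; -‿+-comm; x[y-z]≈xy-xz; [y-z]x≈yx-zx)
  open import Algebra.Properties.CommutativeSemigroup *-commutativeSemigroup using (x∙yz≈y∙xz)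
  open import Algebra.Properties.AbelianGroup +-abelianGroup using (//-rightDividesˡ)
  open import Algebra.Properties.Semiring.Sum semiring public
    using ( sum-syntax; sum-cong-≋; sum-cong-≗; sum-replicate-zero
          ; ∑-distrib-+; ∑-comm; ∑-permute; *-distribˡ-sum; *-distribʳ-sum)
  open import Relation.Binary.Reasoning.Setoid setoid

  ∑-neg : ∀ {n} (f : Fin n → Carrier) → ∑[ x < n ] (- f x) ≈ - ∑[ x < n ] f x
  ∑-neg {zero}  f = sym -0#≈0#
  ∑-neg {suc n} f = trans (+-congˡ (∑-neg (λ x → f (fsuc x)))) (-‿+-comm _ _)

  ∑-− : ∀ {n} (f g : Fin n → Carrier) → ∑[ x < n ] (f x - g x) ≈ ∑[ x < n ] f x - ∑[ x < n ] g x
  ∑-− {n} f g = trans (∑-distrib-+ f (λ x → - g x)) (+-congˡ (∑-neg g))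

  x[a-b-c]≈xa-xb-xc : ∀ x a b c → x * (a - b - c) ≈ x * a - x * b - x * c
  x[a-b-c]≈xa-xb-xc x a b c = trans (x[y-z]≈xy-xz x (a - b) c) (+-congʳ (x[y-z]≈xy-xz x a b))

  [a-b-c]x≈ax-bx-cx : ∀ x a b c → (a - b - c) * x ≈ a * x - b * x - c * x
  [a-b-c]x≈ax-bx-cx x a b c = trans ([y-z]x≈yx-zx x (a - b) c) (+-congʳ ([y-z]x≈yx-zx x a b))

  ∑-−− : ∀ {n} (f g h : Fin n → Carrier) →
         ∑[ x < n ] (f x - g x - h x) ≈ ∑[ x < n ] f x - ∑[ x < n ] g x - ∑[ x < n ] h x
  ∑-−− f g h = trans (∑-− (λ x → f x - g x) h) (+-congʳ (∑-− f g))

  x-y-z+z+y≈x : ∀ x y z → x - y - z + z + y ≈ x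
  x-y-z+z+y≈x x y z = trans (+-congʳ (//-rightDividesˡ z (x - y))) (//-rightDividesˡ y x)

  ∑-zero : ∀ {n} {f : Fin n → Carrier} → (∀ x → f x ≈ 0#) → ∑[ x < n ] f x ≈ 0#
  ∑-zero {n} f≈0 = trans (sum-cong-≋ f≈0) (sum-replicate-zero n)

  ∑-single : ∀ {n} {f : Fin n → Carrier} y → (∀ x → x ≢ y → f x ≈ 0#) → ∑[ x < n ] f x ≈ f y
  ∑-single fzero    f≈0 = trans (+-congˡ (∑-zero λ x → f≈0 (fsuc x) λ ())) (+-identityʳ _)
  ∑-single (fsuc y) f≈0 =
    trans (+-cong (f≈0 fzero λ ()) (∑-single y λ x x≢y → f≈0 (fsuc x) (λ e → x≢y (suc-injective e))))
          (+-identityˡ _)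

  ∑-∑-comm : ∀ {n k} (g : Fin n → Carrier) (f : Fin k → Carrier) (h : Fin n → Fin k → Carrier) →
             ∑[ x < n ] (g x * ∑[ y < k ] (f y * h x y)) ≈ ∑[ y < k ] (f y * ∑[ x < n ] (g x * h x y))
  ∑-∑-comm {n} {k} g f h = begin
    ∑[ x < n ] (g x * ∑[ y < k ] (f y * h x y))
      ≈⟨ sum-cong-≋ (λ x → *-distribˡ-sum (g x) (λ y → f y * h x y)) ⟩
    ∑[ x < n ] ∑[ y < k ] (g x * (f y * h x y))
      ≈⟨ ∑-comm (λ x y → g x * (f y * h x y)) ⟩
    ∑[ y < k ] ∑[ x < n ] (g x * (f y * h x y))
      ≈⟨ sum-cong-≋ (λ y → sum-cong-≋ λ x → x∙yz≈y∙xz (g x) (f y) _) ⟩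
    ∑[ y < k ] ∑[ x < n ] (f y * (g x * h x y))
      ≈⟨ sum-cong-≋ (λ y → *-distribˡ-sum (f y) (λ x → g x * h x y)) ⟨
    ∑[ y < k ] (f y * ∑[ x < n ] (g x * h x y)) ∎

  ∑-rotate₃ : ∀ {n} (f g h : Fin n → Carrier) (F : Fin n → Fin n → Fin n → Carrier) →
              ∑[ x < n ] (f x * ∑[ y < n ] (g y * ∑[ z < n ] (h z * F x y z)))
              ≈ ∑[ y < n ] (g y * ∑[ z < n ] (h z * ∑[ x < n ] (f x * F x y z)))
  ∑-rotate₃ {n} f g h F =
    trans (∑-∑-comm f g λ x y → ∑[ z < n ] (h z * F x y z))
          (sum-cong-≋ λ y → *-congˡ (∑-∑-comm f h λ x z → F x y z))

transpose : ∀ {a ℓ} {K : Field a ℓ} {m} {M X : FinAbGroup m} → DualPairing K M X → DualPairing K X M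
transpose P = record
  { ⟨_,_⟩   = λ x α → ⟨ α , x ⟩
  ; mulˡ    = λ x y α → mulʳ α x y
  ; mulʳ    = λ x α β → mulˡ α β x
  ; unitˡ   = unitʳ
  ; unitʳ   = unitˡ
  ; nondegˡ = nondegʳ
  ; nondegʳ = nondegˡ
  }
  where open DualPairing P

¬¬-∀Fin : ∀ {p n} {P : Fin n → Set p} → (∀ k → ¬ ¬ P k) → ¬ ¬ (∀ k → P k)
¬¬-∀Fin {n = zero}  ¬¬P ¬∀P = ¬∀P λ ()
¬¬-∀Fin {n = suc n} ¬¬P ¬∀P = ¬¬P fzero λ P₀ → ¬¬-∀Fin (λ k → ¬¬P (fsuc k)) λ P₊ →
  ¬∀P λ { fzero → P₀ ; (fsuc k) → P₊ k }

module FieldSums {a ℓ : Level} (K : Field a ℓ) where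
  open Field K
  open Sums commutativeRing public

  -- Through ifDec, so that δ K M α is definitionally 𝟙 (α ≟ ε).
  𝟙 : ∀ {p} {P : Set p} → Dec P → Carrier
  𝟙 d = ifDec K d 1# 0#

  𝟙-yes : ∀ {p} {P : Set p} (d : Dec P) → P → 𝟙 d ≈ 1#
  𝟙-yes (yes _) _  = refl
  𝟙-yes (no ¬p) p  = contradiction p ¬p

  𝟙-no : ∀ {p} {P : Set p} (d : Dec P) → ¬ P → 𝟙 d ≈ 0#
  𝟙-no (yes p) ¬p = contradiction p ¬p
  𝟙-no (no _)  _  = refl

  𝟙-cong : ∀ {p q} {P : Set p} {Q : Set q} (d : Dec P) (e : Dec Q) → (P → Q) → (Q → P) → 𝟙 d ≈ 𝟙 e
  𝟙-cong (yes _) (yes _) _   _   = refl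
  𝟙-cong (yes p) (no ¬q) P→Q _   = contradiction (P→Q p) ¬q
  𝟙-cong (no ¬p) (yes q) _   Q→P = contradiction (Q→P q) ¬p
  𝟙-cong (no _)  (no _)  _   _   = refl

  ∑-𝟙 : ∀ {n} (f : Fin n → Carrier) y → ∑[ x < n ] (f x * 𝟙 (x ≟ y)) ≈ f y
  ∑-𝟙 f y = trans (∑-single y λ x x≢y → trans (*-congˡ (𝟙-no (x ≟ y) x≢y)) (zeroʳ (f x)))
                  (trans (*-congˡ (𝟙-yes (y ≟ y) ≡.refl)) (*-identityʳ (f y)))

  ∑-𝟙ˡ : ∀ {n} (f : Fin n → Carrier) y → ∑[ x < n ] (𝟙 (x ≟ y) * f x) ≈ f y
  ∑-𝟙ˡ f y = trans (sum-cong-≋ λ x → *-comm (𝟙 (x ≟ y)) (f x)) (∑-𝟙 f y)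

  ∑-1 : ∀ n → ∑[ x < n ] 1# ≈ fromℕ K n
  ∑-1 zero    = refl
  ∑-1 (suc n) = +-congˡ (∑-1 n)

  sumK≈∑ : ∀ {n} (f : Fin n → Carrier) → sumK K f ≈ ∑[ x < n ] f x
  sumK≈∑ {zero}  f = refl
  sumK≈∑ {suc n} f = +-congˡ (sumK≈∑ (λ x → f (fsuc x)))

module Orthogonality {a ℓ : Level} (K : Field a ℓ) {m} {M X : FinAbGroup m} (P : DualPairing K M X) where
  open Field K
  open FieldSums K
  open DualPairing P
  open import Relation.Binary.Reasoning.Setoid setoid
  private
    module M = FinAbGroupProperties M
    module X = FinAbGroupProperties X

  Orthogonal : Set ℓ
  Orthogonal = ∀ u → ∑[ α < m ] ⟨ α , u ⟩ ≈ fromℕ K m * 𝟙 (u ≟ X.ε)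

  ∑⟨-,u⟩≈⟨α,u⟩*∑⟨-,u⟩ : ∀ u α₀ → ∑[ α < m ] ⟨ α , u ⟩ ≈ ⟨ α₀ , u ⟩ * ∑[ α < m ] ⟨ α , u ⟩
  ∑⟨-,u⟩≈⟨α,u⟩*∑⟨-,u⟩ u α₀ = begin
    ∑[ α < m ] ⟨ α , u ⟩                 ≈⟨ ∑-permute (λ α → ⟨ α , u ⟩) shift ⟩
    ∑[ α < m ] ⟨ α₀ M.∙ α , u ⟩          ≈⟨ sum-cong-≋ (λ α → mulˡ α₀ α u) ⟩
    ∑[ α < m ] (⟨ α₀ , u ⟩ * ⟨ α , u ⟩)  ≈⟨ *-distribˡ-sum ⟨ α₀ , u ⟩ (λ α → ⟨ α , u ⟩) ⟨
    ⟨ α₀ , u ⟩ * ∑[ α < m ] ⟨ α , u ⟩    ∎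
    where shift = permutation (α₀ M.∙_) (α₀ M.⁻¹ M.∙_) (M.\\-leftDividesˡ α₀) (M.\\-leftDividesʳ α₀)

  -- For u ≢ ε, S = ⟨ α , u ⟩ * S for all α only refutes S ≉ 0, as ≈ on K need not be decidable.
  orthogonal-¬¬ : ¬ ¬ Orthogonal
  orthogonal-¬¬ = ¬¬-∀Fin orthogonal-at
    where
    orthogonal-at : ∀ u → ¬ ¬ (∑[ α < m ] ⟨ α , u ⟩ ≈ fromℕ K m * 𝟙 (u ≟ X.ε))
    orthogonal-at u with u ≟ X.ε
    ... | yes ≡.refl = λ ¬orth → ¬orth (begin
      ∑[ α < m ] ⟨ α , X.ε ⟩   ≈⟨ sum-cong-≋ unitʳ ⟩
      ∑[ α < m ] 1#            ≈⟨ ∑-1 m ⟩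
      fromℕ K m                ≈⟨ *-identityʳ _ ⟨
      fromℕ K m * 1#           ∎)
    ... | no u≢ε = ¬¬-map (λ S≈0 → trans S≈0 (sym (zeroʳ _))) ¬¬S≈0
      where
      S = ∑[ α < m ] ⟨ α , u ⟩
      ¬¬S≈0 : ¬ ¬ (S ≈ 0#)
      ¬¬S≈0 S≉0 = u≢ε (nondegʳ u λ α₀ → begin
        ⟨ α₀ , u ⟩                  ≈⟨ *-identityʳ _ ⟨
        ⟨ α₀ , u ⟩ * 1#             ≈⟨ *-congˡ (inverseʳ S S≉0) ⟨
        ⟨ α₀ , u ⟩ * (S * S ⁻¹)     ≈⟨ *-assoc _ _ _ ⟨
        ⟨ α₀ , u ⟩ * S * S ⁻¹       ≈⟨ *-congʳ (∑⟨-,u⟩≈⟨α,u⟩*∑⟨-,u⟩ u α₀) ⟨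
        S * S ⁻¹                    ≈⟨ inverseʳ S S≉0 ⟩
        1#                          ∎)

module Fourier {a ℓ : Level} (K : Field a ℓ) {m} {M X : FinAbGroup m} (P : DualPairing K M X)
    (orthogonal : Orthogonality.Orthogonal K P) (m≉0 : ¬ (Field._≈_ K (fromℕ K m) (Field.0# K))) where
  open Field K
  open FieldSums K
  open DualPairing P
  open import Algebra.Properties.CommutativeSemigroup *-commutativeSemigroup
  open import Relation.Binary.Reasoning.Setoid setoid
  private
    module M = FinAbGroupProperties M
    module X = FinAbGroupProperties X

  m̂ : Carrier
  m̂ = fromℕ K m

  m̂⁻¹*m̂≈1 : m̂ ⁻¹ * m̂ ≈ 1#
  m̂⁻¹*m̂≈1 = trans (*-comm _ _) (inverseʳ m̂ m≉0)

  m̂⁻¹*[m̂*x]≈x : ∀ x → m̂ ⁻¹ * (m̂ * x) ≈ x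
  m̂⁻¹*[m̂*x]≈x x = trans (sym (*-assoc _ _ _)) (trans (*-congʳ m̂⁻¹*m̂≈1) (*-identityˡ x))

  m̂⁻¹*[x*[m̂*y]]≈y*x : ∀ x y → m̂ ⁻¹ * (x * (m̂ * y)) ≈ y * x
  m̂⁻¹*[x*[m̂*y]]≈y*x x y =
    trans (*-congˡ (trans (x∙yz≈y∙xz x m̂ y) (*-congˡ (*-comm x y)))) (m̂⁻¹*[m̂*x]≈x (y * x))

  m̂*-cancelˡ : ∀ {x y} → m̂ * x ≈ m̂ * y → x ≈ y
  m̂*-cancelˡ {x} {y} e = trans (sym (m̂⁻¹*[m̂*x]≈x x)) (trans (*-congˡ e) (m̂⁻¹*[m̂*x]≈x y))

  orthogonal₂ : ∀ u v → ∑[ α < m ] (⟨ α , u ⟩ * ⟨ α , v ⟩) ≈ m̂ * 𝟙 (u X.∙ v ≟ X.ε)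
  orthogonal₂ u v = trans (sum-cong-≋ {m} λ α → sym (mulʳ α u v)) (orthogonal (u X.∙ v))

  inversion : ∀ (f : Fin m → Carrier) a →
              ∑[ α < m ] (⟨ α , a ⟩ * ∑[ w < m ] (f w * ⟨ α , w ⟩)) ≈ m̂ * f (a X.⁻¹)
  inversion f a = begin
    ∑[ α < m ] (⟨ α , a ⟩ * ∑[ w < m ] (f w * ⟨ α , w ⟩))
      ≈⟨ ∑-∑-comm (λ α → ⟨ α , a ⟩) f (λ α w → ⟨ α , w ⟩) ⟩
    ∑[ w < m ] (f w * ∑[ α < m ] (⟨ α , a ⟩ * ⟨ α , w ⟩))
      ≈⟨ sum-cong-≋ {m} (λ w → *-congˡ (orthogonal₂ a w)) ⟩
    ∑[ w < m ] (f w * (m̂ * 𝟙 (a X.∙ w ≟ X.ε)))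
      ≈⟨ sum-cong-≋ {m} (λ w → trans (x∙yz≈y∙xz (f w) m̂ _) (*-congˡ (*-congˡ (𝟙[a∙w≡ε]≈𝟙[w≡a⁻¹] w)))) ⟩
    ∑[ w < m ] (m̂ * (f w * 𝟙 (w ≟ a X.⁻¹)))
      ≈⟨ *-distribˡ-sum m̂ (λ w → f w * 𝟙 (w ≟ a X.⁻¹)) ⟨
    m̂ * ∑[ w < m ] (f w * 𝟙 (w ≟ a X.⁻¹))
      ≈⟨ *-congˡ (∑-𝟙 f (a X.⁻¹)) ⟩
    m̂ * f (a X.⁻¹) ∎
    where
    𝟙[a∙w≡ε]≈𝟙[w≡a⁻¹] : ∀ w → 𝟙 (a X.∙ w ≟ X.ε) ≈ 𝟙 (w ≟ a X.⁻¹)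
    𝟙[a∙w≡ε]≈𝟙[w≡a⁻¹] w =
      𝟙-cong (a X.∙ w ≟ X.ε) (w ≟ a X.⁻¹) (X.inverseʳ-unique a w) λ { ≡.refl → X.inverseʳ a }

  cocycleTransform : (Fin m → Fin m → Carrier) → Fin m → Fin m → Fin m → Carrier
  cocycleTransform J a b d =
    ∑[ α < m ] (⟨ α , a ⟩ * ∑[ β < m ] (⟨ β , b ⟩ * ∑[ γ < m ] (⟨ γ , d ⟩ * (J α β * J (α M.∙ β) γ))))

  cocycleTransform-rotate : ∀ (J : Fin m → Fin m → Carrier) → (∀ α β → J α β ≈ J β α) →
    (∀ α β γ → J α β * J (α M.∙ β) γ ≈ J α (β M.∙ γ) * J β γ) →
    ∀ a b d → cocycleTransform J a b d ≈ cocycleTransform J b d a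
  cocycleTransform-rotate J J-sym J-cocycle a b d = begin
    cocycleTransform J a b d
      ≈⟨ ∑-cong₃ (λ α β γ → J-cocycle α β γ) ⟩
    ∑[ α < m ] (⟨ α , a ⟩ * ∑[ β < m ] (⟨ β , b ⟩ * ∑[ γ < m ] (⟨ γ , d ⟩ * (J α (β M.∙ γ) * J β γ))))
      ≈⟨ ∑-rotate₃ (λ α → ⟨ α , a ⟩) (λ β → ⟨ β , b ⟩) (λ γ → ⟨ γ , d ⟩) (λ α β γ → J α (β M.∙ γ) * J β γ) ⟩
    ∑[ β < m ] (⟨ β , b ⟩ * ∑[ γ < m ] (⟨ γ , d ⟩ * ∑[ α < m ] (⟨ α , a ⟩ * (J α (β M.∙ γ) * J β γ))))
      ≈⟨ ∑-cong₃ (λ β γ α → trans (*-comm _ _) (*-congˡ (J-sym α (β M.∙ γ)))) ⟩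
    cocycleTransform J b d a ∎
    where
    ∑-cong₃ : ∀ {a b d} {F G : Fin m → Fin m → Fin m → Carrier} → (∀ x y z → F x y z ≈ G x y z) →
              ∑[ x < m ] (⟨ x , a ⟩ * ∑[ y < m ] (⟨ y , b ⟩ * ∑[ z < m ] (⟨ z , d ⟩ * F x y z)))
              ≈ ∑[ x < m ] (⟨ x , a ⟩ * ∑[ y < m ] (⟨ y , b ⟩ * ∑[ z < m ] (⟨ z , d ⟩ * G x y z)))
    ∑-cong₃ F≈G =
      sum-cong-≋ {m} λ x → *-congˡ (sum-cong-≋ {m} λ y → *-congˡ (sum-cong-≋ {m} λ z → *-congˡ (F≈G x y z)))

  ⟪_⟫ : (Fin m → Fin m → Carrier) → Fin m → Fin m → Carrier
  ⟪ h ⟫ α β = ∑[ u < m ] (⟨ α , u ⟩ * ∑[ v < m ] (h u v * ⟨ β , v ⟩))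

  ⟪⟫-−− : ∀ f g h α β → ⟪ (λ u v → f u v - g u v - h u v) ⟫ α β ≈ ⟪ f ⟫ α β - ⟪ g ⟫ α β - ⟪ h ⟫ α β
  ⟪⟫-−− f g h α β = begin
    ∑[ u < m ] (⟨ α , u ⟩ * ∑[ v < m ] ((f u v - g u v - h u v) * ⟨ β , v ⟩))
      ≈⟨ sum-cong-≋ {m} (λ u → *-congˡ (inner u)) ⟩
    ∑[ u < m ] (⟨ α , u ⟩ * (Sf u - Sg u - Sh u))
      ≈⟨ sum-cong-≋ {m} (λ u → x[a-b-c]≈xa-xb-xc _ _ _ _) ⟩
    ∑[ u < m ] (⟨ α , u ⟩ * Sf u - ⟨ α , u ⟩ * Sg u - ⟨ α , u ⟩ * Sh u)
      ≈⟨ ∑-−− (λ u → ⟨ α , u ⟩ * Sf u) (λ u → ⟨ α , u ⟩ * Sg u) (λ u → ⟨ α , u ⟩ * Sh u) ⟩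
    ⟪ f ⟫ α β - ⟪ g ⟫ α β - ⟪ h ⟫ α β ∎
    where
    Sf Sg Sh : Fin m → Carrier
    Sf u = ∑[ v < m ] (f u v * ⟨ β , v ⟩)
    Sg u = ∑[ v < m ] (g u v * ⟨ β , v ⟩)
    Sh u = ∑[ v < m ] (h u v * ⟨ β , v ⟩)
    inner : ∀ u → ∑[ v < m ] ((f u v - g u v - h u v) * ⟨ β , v ⟩) ≈ Sf u - Sg u - Sh u
    inner u = trans (sum-cong-≋ {m} λ v → [a-b-c]x≈ax-bx-cx _ _ _ _)
                    (∑-−− (λ v → f u v * ⟨ β , v ⟩) (λ v → g u v * ⟨ β , v ⟩) (λ v → h u v * ⟨ β , v ⟩))

  module Kernel (J : Fin m → Fin m → Carrier) (h : Fin m → Fin m → Carrier)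
      (J≈⟪h⟫ : ∀ α β → J α β ≈ m̂ ⁻¹ * ⟪ h ⟫ α β) where

    inversionʳ : ∀ α d → ∑[ γ < m ] (⟨ γ , d ⟩ * J α γ) ≈ ∑[ u < m ] (h u (d X.⁻¹) * ⟨ α , u ⟩)
    inversionʳ α d = begin
      ∑[ γ < m ] (⟨ γ , d ⟩ * J α γ)
        ≈⟨ sum-cong-≋ {m} (λ γ → trans (*-congˡ (J≈⟪h⟫ α γ)) (x∙yz≈y∙xz _ _ _)) ⟩
      ∑[ γ < m ] (m̂ ⁻¹ * (⟨ γ , d ⟩ * ⟪ h ⟫ α γ))
        ≈⟨ *-distribˡ-sum (m̂ ⁻¹) (λ γ → ⟨ γ , d ⟩ * ⟪ h ⟫ α γ) ⟨
      m̂ ⁻¹ * ∑[ γ < m ] (⟨ γ , d ⟩ * ⟪ h ⟫ α γ)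
        ≈⟨ *-congˡ (∑-∑-comm (λ γ → ⟨ γ , d ⟩) (λ u → ⟨ α , u ⟩) λ γ u → ∑[ v < m ] (h u v * ⟨ γ , v ⟩)) ⟩
      m̂ ⁻¹ * ∑[ u < m ] (⟨ α , u ⟩ * ∑[ γ < m ] (⟨ γ , d ⟩ * ∑[ v < m ] (h u v * ⟨ γ , v ⟩)))
        ≈⟨ *-congˡ (sum-cong-≋ {m} λ u → *-congˡ (inversion (h u) d)) ⟩
      m̂ ⁻¹ * ∑[ u < m ] (⟨ α , u ⟩ * (m̂ * h u (d X.⁻¹)))
        ≈⟨ *-distribˡ-sum (m̂ ⁻¹) (λ u → ⟨ α , u ⟩ * (m̂ * h u (d X.⁻¹))) ⟩
      ∑[ u < m ] (m̂ ⁻¹ * (⟨ α , u ⟩ * (m̂ * h u (d X.⁻¹))))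
        ≈⟨ sum-cong-≋ {m} (λ u → m̂⁻¹*[x*[m̂*y]]≈y*x _ _) ⟩
      ∑[ u < m ] (h u (d X.⁻¹) * ⟨ α , u ⟩) ∎

    inversion₂ : ∀ a b →
      ∑[ α < m ] (⟨ α , a ⟩ * ∑[ β < m ] (⟨ β , b ⟩ * J α β)) ≈ m̂ * h (a X.⁻¹) (b X.⁻¹)
    inversion₂ a b =
      trans (sum-cong-≋ {m} λ α → *-congˡ (inversionʳ α b)) (inversion (λ u → h u (b X.⁻¹)) a)

    cocycleTransform≈ : ∀ a b d →
      cocycleTransform J a b d ≈ m̂ * ∑[ w < m ] (h w (d X.⁻¹) * h ((a X.∙ w) X.⁻¹) ((b X.∙ w) X.⁻¹))
    cocycleTransform≈ a b d = begin
      cocycleTransform J a b d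
        ≈⟨ sum-cong-≋ {m} (λ α → *-congˡ (trans (sum-cong-≋ {m} λ β → *-congˡ (innermost α β)) (middle α))) ⟩
      ∑[ α < m ] (⟨ α , a ⟩ * ∑[ w < m ] (H w * ⟨ α , w ⟩ * G α w))
        ≈⟨ sum-cong-≋ {m} (λ α → *-congˡ (sum-cong-≋ {m} λ w → *-assoc (H w) _ _)) ⟩
      ∑[ α < m ] (⟨ α , a ⟩ * ∑[ w < m ] (H w * (⟨ α , w ⟩ * G α w)))
        ≈⟨ ∑-∑-comm (λ α → ⟨ α , a ⟩) H (λ α w → ⟨ α , w ⟩ * G α w) ⟩
      ∑[ w < m ] (H w * ∑[ α < m ] (⟨ α , a ⟩ * (⟨ α , w ⟩ * G α w)))
        ≈⟨ sum-cong-≋ {m} (λ w → *-congˡ (sum-cong-≋ {m} λ α →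
             trans (sym (*-assoc _ _ _)) (*-congʳ (sym (mulʳ α a w))))) ⟩
      ∑[ w < m ] (H w * ∑[ α < m ] (⟨ α , a X.∙ w ⟩ * G α w))
        ≈⟨ sum-cong-≋ {m} (λ w → *-congˡ (inversion₂ (a X.∙ w) (b X.∙ w))) ⟩
      ∑[ w < m ] (H w * (m̂ * h ((a X.∙ w) X.⁻¹) ((b X.∙ w) X.⁻¹)))
        ≈⟨ sum-cong-≋ {m} (λ w → x∙yz≈y∙xz (H w) m̂ _) ⟩
      ∑[ w < m ] (m̂ * (H w * h ((a X.∙ w) X.⁻¹) ((b X.∙ w) X.⁻¹)))
        ≈⟨ *-distribˡ-sum m̂ (λ w → H w * h ((a X.∙ w) X.⁻¹) ((b X.∙ w) X.⁻¹)) ⟨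
      m̂ * ∑[ w < m ] (H w * h ((a X.∙ w) X.⁻¹) ((b X.∙ w) X.⁻¹)) ∎
      where
      H : Fin m → Carrier
      H w = h w (d X.⁻¹)
      G : Fin m → Fin m → Carrier
      G α w = ∑[ β < m ] (⟨ β , b X.∙ w ⟩ * J α β)

      innermost : ∀ α β → ∑[ γ < m ] (⟨ γ , d ⟩ * (J α β * J (α M.∙ β) γ))
                          ≈ J α β * ∑[ w < m ] (H w * (⟨ α , w ⟩ * ⟨ β , w ⟩))
      innermost α β = begin
        ∑[ γ < m ] (⟨ γ , d ⟩ * (J α β * J (α M.∙ β) γ))
          ≈⟨ sum-cong-≋ {m} (λ γ → x∙yz≈y∙xz _ (J α β) _) ⟩
        ∑[ γ < m ] (J α β * (⟨ γ , d ⟩ * J (α M.∙ β) γ))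
          ≈⟨ *-distribˡ-sum (J α β) (λ γ → ⟨ γ , d ⟩ * J (α M.∙ β) γ) ⟨
        J α β * ∑[ γ < m ] (⟨ γ , d ⟩ * J (α M.∙ β) γ)
          ≈⟨ *-congˡ (inversionʳ (α M.∙ β) d) ⟩
        J α β * ∑[ w < m ] (H w * ⟨ α M.∙ β , w ⟩)
          ≈⟨ *-congˡ (sum-cong-≋ {m} λ w → *-congˡ (mulˡ α β w)) ⟩
        J α β * ∑[ w < m ] (H w * (⟨ α , w ⟩ * ⟨ β , w ⟩)) ∎

      middle : ∀ α → ∑[ β < m ] (⟨ β , b ⟩ * (J α β * ∑[ w < m ] (H w * (⟨ α , w ⟩ * ⟨ β , w ⟩))))
                     ≈ ∑[ w < m ] (H w * ⟨ α , w ⟩ * G α w)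
      middle α = begin
        ∑[ β < m ] (⟨ β , b ⟩ * (J α β * ∑[ w < m ] (H w * (⟨ α , w ⟩ * ⟨ β , w ⟩))))
          ≈⟨ sum-cong-≋ {m} (λ β →
               trans (sym (*-assoc _ _ _)) (*-congˡ (sum-cong-≋ {m} λ w → sym (*-assoc _ _ _)))) ⟩
        ∑[ β < m ] (⟨ β , b ⟩ * J α β * ∑[ w < m ] (H w * ⟨ α , w ⟩ * ⟨ β , w ⟩))
          ≈⟨ ∑-∑-comm (λ β → ⟨ β , b ⟩ * J α β) (λ w → H w * ⟨ α , w ⟩) (λ β w → ⟨ β , w ⟩) ⟩
        ∑[ w < m ] (H w * ⟨ α , w ⟩ * ∑[ β < m ] (⟨ β , b ⟩ * J α β * ⟨ β , w ⟩))
          ≈⟨ sum-cong-≋ {m} (λ w → *-congˡ (sum-cong-≋ {m} λ β →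
               trans (xy∙z≈xz∙y _ _ _) (*-congʳ (sym (mulʳ β b w))))) ⟩
        ∑[ w < m ] (H w * ⟨ α , w ⟩ * G α w) ∎

module ⊕-Indicators {a ℓ : Level} (K : Field a ℓ) {m} (X : FinAbGroup m) (c : Fin m)
    (c∙c≡ε : FinAbGroup._∙_ X c c ≡ FinAbGroup.ε X) (i : Fin m → Fin m)
    (i-flip : ∀ x → x ≢ c → i x ≡ FinAbGroup._∙_ X x (i (FinAbGroup._⁻¹ X x))) where
  open Field K hiding (_⁻¹)
  open FieldSums K
  open FinAbGroupProperties X using (_∙_; ε; _⁻¹; ⁻¹-∙-comm; x∙y⁻¹≈ε⇒x≈y; x≈y⇒x∙y⁻¹≈ε)
  open ⊕-Properties X c c∙c≡ε i i-flip
  open import Algebra.Properties.Ring ring using (-0#≈0#)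
  open import Algebra.Properties.CommutativeSemigroup *-commutativeSemigroup
  open import Relation.Binary.Reasoning.Setoid setoid
  private module +-CS = Algebra.Properties.CommutativeSemigroup +-commutativeSemigroup

  isε : F X → Carrier
  isε nothing  = 0#
  isε (just u) = 𝟙 (u ≟ ε)

  isε≈1⇒≡ε : ∀ z → isε z ≈ 1# → z ≡ just ε
  isε≈1⇒≡ε nothing  0≈1 = contradiction (sym 0≈1) 1≉0
  isε≈1⇒≡ε (just u) e with u ≟ ε
  ... | yes u≡ε = ≡.cong just u≡ε
  ... | no _    = contradiction (sym e) 1≉0

  isε-≢ε : ∀ {z} → z ≢ just ε → isε z ≈ 0#
  isε-≢ε {nothing} _   = refl
  isε-≢ε {just u}  u≢ε = 𝟙-no (u ≟ ε) λ u≡ε → u≢ε (≡.cong just u≡ε)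

  𝟙≢c : Fin m → Carrier
  𝟙≢c x = 𝟙 (¬? (x ≟ c))

  E : Fin m → Fin m → Carrier
  E u v = isε (just u ⊕ just v)

  fibre : Fin m → Fin m → Fin m → Carrier
  fibre u v x = 𝟙≢c x * (𝟙 (u ≟ i x) * 𝟙 (v ≟ q x))

  fibre≈0 : ∀ {u v} x → ¬ (x ≢ c × i x ≡ u × q x ≡ v) → fibre u v x ≈ 0#
  fibre≈0 {u} {v} x ¬x∈fibre with x ≟ c | u ≟ i x | v ≟ q x
  ... | yes _   | _        | _        = zeroˡ _
  ... | no _    | no _     | _        = trans (*-congˡ (zeroˡ _)) (zeroʳ _)
  ... | no _    | yes _    | no _     = trans (*-congˡ (zeroʳ _)) (zeroʳ _)
  ... | no x≢c  | yes u≡ix | yes v≡qx = contradiction (x≢c , ≡.sym u≡ix , ≡.sym v≡qx) ¬x∈fibre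

  -- The pairs with u ⊕ v = 1 are the (i x, q x) with x ≢ c, each coming from a single x.
  E≈∑fibre : ∀ u v → E u v ≈ ∑[ x < m ] fibre u v x
  E≈∑fibre u v with Maybe.≡-dec _≟_ (just u ⊕ just v) (just ε)
  ... | no u⊕v≢ε = trans (isε-≢ε u⊕v≢ε) (sym (∑-zero λ x → fibre≈0 x λ (x≢c , ix≡u , qx≡v) →
    u⊕v≢ε (≡.trans (≡.cong₂ (λ s t → just s ⊕ just t) (≡.sym ix≡u) (≡.sym qx≡v)) (i⊕q≡ε x≢c))))
  ... | yes u⊕v≡ε with ⊕≡ε⇒ u⊕v≡ε
  ...   | x₀ , x₀≢c , ix₀≡u , qx₀≡v = begin
    isε (just u ⊕ just v)     ≡⟨ ≡.cong isε u⊕v≡ε ⟩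
    𝟙 (ε ≟ ε)                 ≈⟨ 𝟙-yes (ε ≟ ε) ≡.refl ⟩
    1#                        ≈⟨ fibre-x₀≈1 ⟨
    fibre u v x₀              ≈⟨ ∑-single x₀ (λ x x≢x₀ → fibre≈0 x λ (_ , ix≡u , qx≡v) →
      x≢x₀ (⟨i,q⟩-injective (≡.trans ix≡u (≡.sym ix₀≡u)) (≡.trans qx≡v (≡.sym qx₀≡v)))) ⟨
    ∑[ x < m ] fibre u v x    ∎
    where
    fibre-x₀≈1 : fibre u v x₀ ≈ 1#
    fibre-x₀≈1 = trans (*-cong (𝟙-yes (¬? (x₀ ≟ c)) x₀≢c)
                               (*-cong (𝟙-yes (u ≟ i x₀) (≡.sym ix₀≡u)) (𝟙-yes (v ≟ q x₀) (≡.sym qx₀≡v))))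
                       (trans (*-identityˡ _) (*-identityˡ _))

  sumExcept≈∑𝟙≢c* : ∀ f → sumExcept K c f ≈ ∑[ x < m ] (𝟙≢c x * f x)
  sumExcept≈∑𝟙≢c* f = trans (sumK≈∑ λ x → ifDec K (x ≟ c) 0# (f x)) (sum-cong-≋ {m} λ x → ifDec≈𝟙≢c* x)
    where
    ifDec≈𝟙≢c* : ∀ x → ifDec K (x ≟ c) 0# (f x) ≈ 𝟙≢c x * f x
    ifDec≈𝟙≢c* x with x ≟ c
    ... | yes _ = sym (zeroˡ (f x))
    ... | no _  = sym (*-identityˡ (f x))

  ∑E[u,-]*k : ∀ (k : Fin m → Carrier) u →
              ∑[ v < m ] (E u v * k v) ≈ ∑[ x < m ] (𝟙≢c x * 𝟙 (u ≟ i x) * k (q x))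
  ∑E[u,-]*k k u = begin
    ∑[ v < m ] (E u v * k v)
      ≈⟨ sum-cong-≋ {m} (λ v → *-congʳ (E≈∑fibre u v)) ⟩
    ∑[ v < m ] (∑[ x < m ] fibre u v x * k v)
      ≈⟨ sum-cong-≋ {m} (λ v → *-distribʳ-sum (k v) (fibre u v)) ⟩
    ∑[ v < m ] ∑[ x < m ] (fibre u v x * k v)
      ≈⟨ ∑-comm (λ v x → fibre u v x * k v) ⟩
    ∑[ x < m ] ∑[ v < m ] (fibre u v x * k v)
      ≈⟨ sum-cong-≋ {m} (λ x → sum-cong-≋ {m} λ v →
           trans (trans (*-congʳ (sym (*-assoc _ _ _))) (*-assoc _ _ _)) (*-congˡ (*-comm _ _))) ⟩
    ∑[ x < m ] ∑[ v < m ] (𝟙≢c x * 𝟙 (u ≟ i x) * (k v * 𝟙 (v ≟ q x)))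
      ≈⟨ sum-cong-≋ {m} (λ x → *-distribˡ-sum (𝟙≢c x * 𝟙 (u ≟ i x)) λ v → k v * 𝟙 (v ≟ q x)) ⟨
    ∑[ x < m ] (𝟙≢c x * 𝟙 (u ≟ i x) * ∑[ v < m ] (k v * 𝟙 (v ≟ q x)))
      ≈⟨ sum-cong-≋ {m} (λ x → *-congˡ (∑-𝟙 k (q x))) ⟩
    ∑[ x < m ] (𝟙≢c x * 𝟙 (u ≟ i x) * k (q x)) ∎

  reindex : ∀ (g k : Fin m → Carrier) →
            ∑[ x < m ] (𝟙≢c x * (g (i x) * k (q x))) ≈ ∑[ u < m ] (g u * ∑[ v < m ] (E u v * k v))
  reindex g k = sym (begin
    ∑[ u < m ] (g u * ∑[ v < m ] (E u v * k v))
      ≈⟨ sum-cong-≋ {m} (λ u → *-congˡ (trans (∑E[u,-]*k k u) (sum-cong-≋ {m} λ x → xy∙z≈xz∙y _ _ _))) ⟩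
    ∑[ u < m ] (g u * ∑[ x < m ] (𝟙≢c x * k (q x) * 𝟙 (u ≟ i x)))
      ≈⟨ ∑-∑-comm g (λ x → 𝟙≢c x * k (q x)) (λ u x → 𝟙 (u ≟ i x)) ⟩
    ∑[ x < m ] (𝟙≢c x * k (q x) * ∑[ u < m ] (g u * 𝟙 (u ≟ i x)))
      ≈⟨ sum-cong-≋ {m} (λ x → trans (*-congˡ (∑-𝟙 g (i x))) (xy∙z≈x∙zy _ _ _)) ⟩
    ∑[ x < m ] (𝟙≢c x * (g (i x) * k (q x))) ∎)

  Ê : F X → F X → Carrier
  Ê z w = isε (z ⊕ w) - isε z - isε w

  E* : Fin m → Fin m → Carrier
  E* u v = Ê (just u) (just v)

  extend₀ : (Fin m → Carrier) → F X → Carrier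
  extend₀ f nothing  = 0#
  extend₀ f (just s) = f s

  ∑-*isε[z·w⁻¹] : ∀ (f : Fin m → Carrier) z → ∑[ w < m ] (f w * isε (z · just (w ⁻¹))) ≈ extend₀ f z
  ∑-*isε[z·w⁻¹] f nothing  = ∑-zero λ w → zeroʳ (f w)
  ∑-*isε[z·w⁻¹] f (just s) = trans (sum-cong-≋ {m} λ w → *-congˡ (𝟙-cong (s ∙ w ⁻¹ ≟ ε) (w ≟ s)
                                  (λ e → ≡.sym (x∙y⁻¹≈ε⇒x≈y s w e)) (λ e → x≈y⇒x∙y⁻¹≈ε (≡.sym e))))
                              (∑-𝟙 f s)

  extend₀-Ê : ∀ z w → extend₀ (λ s → Ê (just s) w) z ≈ Ê z w
  extend₀-Ê nothing  w =
    sym (trans (+-congʳ (trans (+-congˡ -0#≈0#) (+-identityʳ _))) (-‿inverseʳ (isε w)))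
  extend₀-Ê (just s) w = refl

  Q : F X → F X → F X → Carrier
  Q A B D = Ê (A ⊕ B) D - Ê A D - Ê B D

  ∑E*E*≈Q : ∀ a b d →
            ∑[ w < m ] (E* w (d ⁻¹) * E* ((a ∙ w) ⁻¹) ((b ∙ w) ⁻¹)) ≈ Q (just (a ⁻¹)) (just (b ⁻¹)) (just (d ⁻¹))
  ∑E*E*≈Q a b d = begin
    ∑[ w < m ] (f w * E* ((a ∙ w) ⁻¹) ((b ∙ w) ⁻¹))
      ≡⟨ sum-cong-≗ (λ w → ≡.cong₂ (λ s t → f w * Ê s t) (≡.cong just (≡.sym (⁻¹-∙-comm a w)))
                                                          (≡.cong just (≡.sym (⁻¹-∙-comm b w)))) ⟩
    ∑[ w < m ] (f w * Ê (A · W w) (B · W w))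
      ≡⟨ sum-cong-≗ (λ w → ≡.cong (λ z → f w * (isε z - isε (A · W w) - isε (B · W w)))
                                  (≡.sym (·-distribʳ-⊕ A B (w ⁻¹)))) ⟩
    ∑[ w < m ] (f w * (isε ((A ⊕ B) · W w) - isε (A · W w) - isε (B · W w)))
      ≈⟨ sum-cong-≋ {m} (λ w → x[a-b-c]≈xa-xb-xc (f w) _ _ _) ⟩
    ∑[ w < m ] (f w * isε ((A ⊕ B) · W w) - f w * isε (A · W w) - f w * isε (B · W w))
      ≈⟨ ∑-−− (λ w → f w * isε ((A ⊕ B) · W w)) (λ w → f w * isε (A · W w)) (λ w → f w * isε (B · W w)) ⟩
    ∑[ w < m ] (f w * isε ((A ⊕ B) · W w))
      - ∑[ w < m ] (f w * isε (A · W w)) - ∑[ w < m ] (f w * isε (B · W w))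
      ≈⟨ +-cong (+-cong (∑-*isε[z·w⁻¹] f (A ⊕ B)) (-‿cong (∑-*isε[z·w⁻¹] f A)))
                (-‿cong (∑-*isε[z·w⁻¹] f B)) ⟩
    extend₀ f (A ⊕ B) - Ê A D - Ê B D
      ≈⟨ +-congʳ (+-congʳ (extend₀-Ê (A ⊕ B) D)) ⟩
    Q A B D ∎
    where
    A B D : F X
    A = just (a ⁻¹)
    B = just (b ⁻¹)
    D = just (d ⁻¹)
    W : Fin m → F X
    W w = just (w ⁻¹)
    f : Fin m → Carrier
    f w = Ê (just w) D

  Ê-comm : ∀ z w → Ê z w ≈ Ê w z
  Ê-comm z w =
    trans (reflexive (≡.cong (λ t → isε t - isε z - isε w) (⊕-comm z w))) (+-CS.xy∙z≈xz∙y _ _ _)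

  S : F X → F X → F X → Carrier
  S A B D = (Ê A B + Ê B D + Ê D A) + (isε A + isε B + isε D)

  isε⊕⊕≈Q+S : ∀ A B D → isε (A ⊕ B ⊕ D) ≈ Q A B D + S A B D
  isε⊕⊕≈Q+S A B D = begin
    isε (A ⊕ B ⊕ D)
      ≈⟨ x-y-z+z+y≈x (isε (A ⊕ B ⊕ D)) (isε (A ⊕ B)) (isε D) ⟨
    Ê (A ⊕ B) D + isε D + isε (A ⊕ B)
      ≈⟨ +-cong (+-congʳ (x-y-z+z+y≈x (Ê (A ⊕ B) D) (Ê A D) (Ê B D)))
                (x-y-z+z+y≈x (isε (A ⊕ B)) (isε A) (isε B)) ⟨
    Q A B D + Ê B D + Ê A D + isε D + (Ê A B + isε B + isε A)
      ≈⟨ solve 7 (λ q ad bd ab a b d →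
           (((q ⊞ bd) ⊞ ad) ⊞ d) ⊞ ((ab ⊞ b) ⊞ a) ⊜ q ⊞ (((ab ⊞ bd) ⊞ ad) ⊞ ((a ⊞ b) ⊞ d))) refl
           (Q A B D) (Ê A D) (Ê B D) (Ê A B) (isε A) (isε B) (isε D) ⟩
    Q A B D + ((Ê A B + Ê B D + Ê A D) + (isε A + isε B + isε D))
      ≈⟨ +-congˡ (+-congʳ (+-congˡ (Ê-comm A D))) ⟩
    Q A B D + S A B D ∎
    where
    open Algebra.Solver.CommutativeMonoid +-commutativeMonoid using (solve; _⊜_) renaming (_⊕_ to _⊞_)

  S-rotate : ∀ A B D → S A B D ≈ S B D A
  S-rotate A B D = +-cong (+-CS.xy∙z≈yz∙x _ _ _) (+-CS.xy∙z≈yz∙x _ _ _)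

module FromJacobi {a ℓ : Level} (K : Field a ℓ) {m : ℕ} (M X : FinAbGroup m) (P : DualPairing K M X)
    (J : Fin m → Fin m → Field.Carrier K) (J-jacobi : IsJacobi K M J)
    (c : Fin m) (c∙c≡ε : FinAbGroup._∙_ X c c ≡ FinAbGroup.ε X)
    (i : Fin m → Fin m) (i-flip : ∀ x → x ≢ c → i x ≡ FinAbGroup._∙_ X x (i (FinAbGroup._⁻¹ X x)))
    (J-def : ∀ α β → Field._≈_ K (J α β)
      (Field._*_ K (Field._⁻¹ K (fromℕ K m))
        (sumExcept K c (λ x → Field._*_ K
          (DualPairing.⟨_,_⟩ P α (i x))
          (DualPairing.⟨_,_⟩ P β
            (FinAbGroup._∙_ X (i x) (FinAbGroup._⁻¹ X x)))))))
    (m≉0 : ¬ (Field._≈_ K (fromℕ K m) (Field.0# K)))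
    (orthogonal : Orthogonality.Orthogonal K P)
    (orthogonalᵀ : Orthogonality.Orthogonal K (transpose P))
    where
  open Field K hiding (_⁻¹)
  open Field K using () renaming (_⁻¹ to _⁻¹ᴷ)
  open FieldSums K
  open DualPairing P
  open FinAbGroupProperties X using (ε; _⁻¹; ⁻¹-involutive)
  open ⊕-Properties X c c∙c≡ε i i-flip
  open ⊕-Indicators K X c c∙c≡ε i i-flip
  open Fourier K P orthogonal m≉0
  open import Algebra.Properties.CommutativeSemigroup *-commutativeSemigroup
  open import Relation.Binary.Reasoning.Setoid setoid
  private module +-CS = Algebra.Properties.CommutativeSemigroup +-commutativeSemigroup

  J≈⟪E⟫ : ∀ α β → J α β ≈ m̂ ⁻¹ᴷ * ⟪ E ⟫ α β
  J≈⟪E⟫ α β = trans (J-def α β)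
    (*-congˡ (trans (sumExcept≈∑𝟙≢c* _) (reindex (λ u → ⟨ α , u ⟩) (λ v → ⟨ β , v ⟩))))

  ⟪[u≡ε]⟫≈m̂δ : ∀ α β → ⟪ (λ u v → 𝟙 (u ≟ ε)) ⟫ α β ≈ m̂ * δ K M β
  ⟪[u≡ε]⟫≈m̂δ α β = begin
    ∑[ u < m ] (⟨ α , u ⟩ * ∑[ v < m ] (𝟙 (u ≟ ε) * ⟨ β , v ⟩))
      ≈⟨ sum-cong-≋ {m} (λ u →
           trans (*-congˡ (sym (*-distribˡ-sum (𝟙 (u ≟ ε)) λ v → ⟨ β , v ⟩))) (x∙yz≈xz∙y _ _ _)) ⟩
    ∑[ u < m ] (⟨ α , u ⟩ * ∑[ v < m ] ⟨ β , v ⟩ * 𝟙 (u ≟ ε))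
      ≈⟨ ∑-𝟙 (λ u → ⟨ α , u ⟩ * ∑[ v < m ] ⟨ β , v ⟩) ε ⟩
    ⟨ α , ε ⟩ * ∑[ v < m ] ⟨ β , v ⟩
      ≈⟨ *-cong (unitʳ α) (orthogonalᵀ β) ⟩
    1# * (m̂ * δ K M β)
      ≈⟨ *-identityˡ _ ⟩
    m̂ * δ K M β ∎

  ⟪[v≡ε]⟫≈m̂δ : ∀ α β → ⟪ (λ u v → 𝟙 (v ≟ ε)) ⟫ α β ≈ m̂ * δ K M α
  ⟪[v≡ε]⟫≈m̂δ α β = begin
    ∑[ u < m ] (⟨ α , u ⟩ * ∑[ v < m ] (𝟙 (v ≟ ε) * ⟨ β , v ⟩))
      ≈⟨ sum-cong-≋ {m} (λ u → *-congˡ (trans (∑-𝟙ˡ (λ v → ⟨ β , v ⟩) ε) (unitʳ β))) ⟩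
    ∑[ u < m ] (⟨ α , u ⟩ * 1#)
      ≈⟨ sum-cong-≋ {m} (λ u → *-identityʳ _) ⟩
    ∑[ u < m ] ⟨ α , u ⟩
      ≈⟨ orthogonalᵀ α ⟩
    m̂ * δ K M α ∎

  J*≈⟪E*⟫ : ∀ α β → Jstar K M J α β ≈ m̂ ⁻¹ᴷ * ⟪ E* ⟫ α β
  J*≈⟪E*⟫ α β = sym (begin
    m̂ ⁻¹ᴷ * ⟪ E* ⟫ α β
      ≈⟨ *-congˡ (⟪⟫-−− E (λ u v → 𝟙 (u ≟ ε)) (λ u v → 𝟙 (v ≟ ε)) α β) ⟩
    m̂ ⁻¹ᴷ * (⟪ E ⟫ α β - ⟪ (λ u v → 𝟙 (u ≟ ε)) ⟫ α β - ⟪ (λ u v → 𝟙 (v ≟ ε)) ⟫ α β)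
      ≈⟨ x[a-b-c]≈xa-xb-xc _ _ _ _ ⟩
    m̂ ⁻¹ᴷ * ⟪ E ⟫ α β - m̂ ⁻¹ᴷ * ⟪ (λ u v → 𝟙 (u ≟ ε)) ⟫ α β - m̂ ⁻¹ᴷ * ⟪ (λ u v → 𝟙 (v ≟ ε)) ⟫ α β
      ≈⟨ +-cong (+-cong (sym (J≈⟪E⟫ α β)) (-‿cong (trans (*-congˡ (⟪[u≡ε]⟫≈m̂δ α β)) (m̂⁻¹*[m̂*x]≈x _))))
                (-‿cong (trans (*-congˡ (⟪[v≡ε]⟫≈m̂δ α β)) (m̂⁻¹*[m̂*x]≈x _))) ⟩
    J α β - δ K M β - δ K M α
      ≈⟨ +-CS.xy∙z≈xz∙y _ _ _ ⟩
    Jstar K M J α β ∎)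

  J*-sym : ∀ α β → Jstar K M J α β ≈ Jstar K M J β α
  J*-sym α β = trans (+-congʳ (+-congʳ (IsJacobi.symm J-jacobi α β))) (+-CS.xy∙z≈xz∙y _ _ _)

  open Kernel (Jstar K M J) E* J*≈⟪E*⟫

  isε⊕⊕-rotate⁻¹ : ∀ a b d → let A = just (a ⁻¹); B = just (b ⁻¹); D = just (d ⁻¹) in
                   isε (A ⊕ B ⊕ D) ≈ isε (B ⊕ D ⊕ A)
  isε⊕⊕-rotate⁻¹ a b d = begin
    isε (A ⊕ B ⊕ D)
      ≈⟨ isε⊕⊕≈Q+S A B D ⟩
    Q A B D + S A B D
      ≈⟨ +-cong (m̂*-cancelˡ (trans (evaluate a b d) (trans rotate (sym (evaluate b d a)))))
                (S-rotate A B D) ⟩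
    Q B D A + S B D A
      ≈⟨ isε⊕⊕≈Q+S B D A ⟨
    isε (B ⊕ D ⊕ A) ∎
    where
    A B D : F X
    A = just (a ⁻¹)
    B = just (b ⁻¹)
    D = just (d ⁻¹)
    evaluate : ∀ a b d →
               m̂ * Q (just (a ⁻¹)) (just (b ⁻¹)) (just (d ⁻¹)) ≈ cocycleTransform (Jstar K M J) a b d
    evaluate a b d = sym (trans (cocycleTransform≈ a b d) (*-congˡ (∑E*E*≈Q a b d)))
    rotate : cocycleTransform (Jstar K M J) a b d ≈ cocycleTransform (Jstar K M J) b d a
    rotate = cocycleTransform-rotate (Jstar K M J) J*-sym (IsJacobi.cocycle J-jacobi) a b d

  isε⊕⊕-rotate : ∀ a b d → isε (just a ⊕ just b ⊕ just d) ≈ isε (just b ⊕ just d ⊕ just a)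
  isε⊕⊕-rotate a b d with isε⊕⊕-rotate⁻¹ (a ⁻¹) (b ⁻¹) (d ⁻¹)
  ... | r rewrite ⁻¹-involutive a | ⁻¹-involutive b | ⁻¹-involutive d = r

  cyclic-ε : ∀ a b d → just a ⊕ just b ⊕ just d ≡ just ε → just b ⊕ just d ⊕ just a ≡ just ε
  cyclic-ε a b d e = isε≈1⇒≡ε _ (begin
    isε (just b ⊕ just d ⊕ just a)   ≈⟨ isε⊕⊕-rotate a b d ⟨
    isε (just a ⊕ just b ⊕ just d)   ≡⟨ ≡.cong isε e ⟩
    𝟙 (ε ≟ ε)                        ≈⟨ 𝟙-yes (ε ≟ ε) ≡.refl ⟩
    1#                               ∎)

  open Associativity cyclic-ε public using (⊕-assoc)

-- m = 0 is excluded by c : Fin m. Equality in F is decidable, which discharges the double negation.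
lemma5p6 : ∀ {a ℓ : Level} (K : Field a ℓ) → CharZero K →
    (m : ℕ) (M X : FinAbGroup m) (P : DualPairing K M X) →
    (J : Fin m → Fin m → Field.Carrier K) → IsJacobi K M J →
    (c : Fin m) → FinAbGroup._∙_ X c c ≡ FinAbGroup.ε X →
    (i : Fin m → Fin m) → IsBijectionOff X c i →
    (∀ x → x ≢ c →
      i x ≡ FinAbGroup._∙_ X x (i (FinAbGroup._⁻¹ X x))) →
    (∀ α β → Field._≈_ K (J α β)
      (Field._*_ K (Field._⁻¹ K (fromℕ K m))
        (sumExcept K c (λ x → Field._*_ K
          (DualPairing.⟨_,_⟩ P α (i x))
          (DualPairing.⟨_,_⟩ P β
            (FinAbGroup._∙_ X (i x) (FinAbGroup._⁻¹ X x))))))) →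
    ∀ u v w → plusF X c i (plusF X c i u v) w ≡ plusF X c i u (plusF X c i v w)
lemma5p6 K char0 (suc k) M X P J J-jacobi c c∙c≡ε i _ i-flip J-def u v w =
  decidable-stable (Maybe.≡-dec _≟_ _ _) λ ¬assoc →
    Orthogonality.orthogonal-¬¬ K P λ orthogonal →
    Orthogonality.orthogonal-¬¬ K (transpose P) λ orthogonalᵀ →
    ¬assoc (FromJacobi.⊕-assoc K M X P J J-jacobi c c∙c≡ε i i-flip J-def (char0 k)
                               orthogonal orthogonalᵀ u v w)
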